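{- Let $\mathbf L=(L,\vee,\wedge,0,1)$ be a complemented modular lattice and $F$ a filter of $\mathbf L$. Then $F$ is a deductive system of $\mathbf L$.
   Context: A bounded lattice is complemented if every element $a$ has some $b$ with $a\vee b=1$, $a\wedge b=0$ (complements need not be unique); lattices are non-trivial. For $a\in L$, $a^+:=\{x\in L\mid a\vee x=1,\ a\wedge x=0\}$, and $a\to b:=\{x\vee(a\wedge b)\mid x\in a^+\}$. A deductive system of $\mathbf L$ is a subset $D\subseteq L$ with $1\in D$ such that whenever $a\in D$, $b\in L$ and $a\to b\subseteq D$, then $b\in D$. A filter is a non-empty up-set closed under $\wedge$. -}

module Defs where

open import Level using (Level; _⊔_; suc)
open import Data.Product using (_×_; ∃-syntax)
open import Relation.Nullary using (¬_)
open import Relation.Unary using (Pred; _∈_)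
open import Algebra.Lattice.Bundles using (Lattice)

record BoundedLattice (c ℓ : Level) : Set (suc (c ⊔ ℓ)) where
  field
    lattice : Lattice c ℓ
  open Lattice lattice public
  field
    𝟘 : Carrier
    𝟙 : Carrier
    𝟘-least    : ∀ x → 𝟘 ∧ x ≈ 𝟘
    𝟙-greatest : ∀ x → x ∧ 𝟙 ≈ x

  infix 4 _≤_
  _≤_ : Carrier → Carrier → Set ℓ
  x ≤ y = x ∧ y ≈ x

  _⁺ : Carrier → Pred Carrier ℓ
  (a ⁺) x = (a ∨ x ≈ 𝟙) × (a ∧ x ≈ 𝟘)

  _⇒_ : Carrier → Carrier → Pred Carrier (c ⊔ ℓ)
  (a ⇒ b) y = ∃[ x ] (x ∈ a ⁺ × y ≈ x ∨ (a ∧ b))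

  Nontrivial : Set ℓ
  Nontrivial = ¬ (𝟘 ≈ 𝟙)

  Modular : Set (c ⊔ ℓ)
  Modular = ∀ x y z → x ≤ z → x ∨ (y ∧ z) ≈ (x ∨ y) ∧ z

  Complemented : Set (c ⊔ ℓ)
  Complemented = ∀ a → ∃[ b ] (b ∈ a ⁺)

  IsFilter : ∀ {p} → Pred Carrier p → Set (c ⊔ ℓ ⊔ p)
  IsFilter F = (∃[ x ] x ∈ F)
             × (∀ {x y} → x ∈ F → x ≤ y → y ∈ F)
             × (∀ {x y} → x ∈ F → y ∈ F → x ∧ y ∈ F)

  IsDeductiveSystem : ∀ {p} → Pred Carrier p → Set (c ⊔ ℓ ⊔ p)
  IsDeductiveSystem D = (𝟙 ∈ D)
    × (∀ {a b} → a ∈ D → (∀ {y} → y ∈ (a ⇒ b) → y ∈ D) → b ∈ D)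

module Submission where

open import Defs
open import Relation.Unary using (Pred; _∈_)
open import Data.Product using (_,_; ∃-syntax)
import Algebra.Lattice.Properties.Lattice as LatticeProperties
import Relation.Binary.Lattice as OrderLattice
import Relation.Binary.Reasoning.Setoid as SetoidReasoning

-- Pick a complement x of a. The element x ∨ (a ∧ b) of a → b lies in F, hence so
-- does a ∧ (x ∨ (a ∧ b)), which by modularity equals (a ∧ b) ∨ (a ∧ x) = a ∧ b ≤ b.

module BoundedLatticeProperties {c ℓ} (L : BoundedLattice c ℓ) where

  open BoundedLattice L
  -- The library's natural order is x ≈ x ∧ y, the symmetric form of _≤_ here.
  open LatticeProperties lattice using (∧-orderTheoreticMeetSemilattice)
  open OrderLattice.MeetSemilattice ∧-orderTheoreticMeetSemilattice
    using () renaming (x∧y≤x to x≈x∧y∧x; x∧y≤y to x∧y≈x∧y∧y)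
  open SetoidReasoning setoid

  x∧y≤x : ∀ x y → x ∧ y ≤ x
  x∧y≤x x y = sym (x≈x∧y∧x x y)

  x∧y≤y : ∀ x y → x ∧ y ≤ y
  x∧y≤y x y = sym (x∧y≈x∧y∧y x y)

  ∨-identityʳ : ∀ x → x ∨ 𝟘 ≈ x
  ∨-identityʳ x = begin
    x ∨ 𝟘        ≈⟨ ∨-congˡ (trans (sym (𝟘-least x)) (∧-comm 𝟘 x)) ⟩
    x ∨ (x ∧ 𝟘)  ≈⟨ ∨-absorbs-∧ x 𝟘 ⟩
    x            ∎

  ≤-respˡ-≈ : ∀ {x y z} → x ≈ y → y ≤ z → x ≤ z
  ≤-respˡ-≈ {x} {y} {z} x≈y y≤z = begin
    x ∧ z  ≈⟨ ∧-congʳ x≈y ⟩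
    y ∧ z  ≈⟨ y≤z ⟩
    y      ≈⟨ x≈y ⟨
    x      ∎

  module _ (modular : Modular) where

    modular-∧-∨ : ∀ {a c} x → c ≤ a → a ∧ (x ∨ c) ≈ c ∨ (a ∧ x)
    modular-∧-∨ {a} {c} x c≤a = begin
      a ∧ (x ∨ c)  ≈⟨ ∧-comm a _ ⟩
      (x ∨ c) ∧ a  ≈⟨ ∧-congʳ (∨-comm x c) ⟩
      (c ∨ x) ∧ a  ≈⟨ modular c x a c≤a ⟨
      c ∨ (x ∧ a)  ≈⟨ ∨-congˡ (∧-comm x a) ⟩
      c ∨ (a ∧ x)  ∎

    ∧-⇒-element : ∀ {a b y} → y ∈ (a ⇒ b) → a ∧ y ≈ a ∧ b
    ∧-⇒-element {a} {b} {y} (x , (_ , a∧x≈𝟘) , y≈x∨a∧b) = begin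
      a ∧ y                  ≈⟨ ∧-congˡ y≈x∨a∧b ⟩
      a ∧ (x ∨ (a ∧ b))      ≈⟨ modular-∧-∨ x (x∧y≤x a b) ⟩
      (a ∧ b) ∨ (a ∧ x)      ≈⟨ ∨-congˡ a∧x≈𝟘 ⟩
      (a ∧ b) ∨ 𝟘            ≈⟨ ∨-identityʳ (a ∧ b) ⟩
      a ∧ b                  ∎

    ∧-⇒-element-≤ : ∀ {a b y} → y ∈ (a ⇒ b) → a ∧ y ≤ b
    ∧-⇒-element-≤ {a} {b} y∈a⇒b = ≤-respˡ-≈ (∧-⇒-element y∈a⇒b) (x∧y≤y a b)

  ⇒-inhabited : Complemented → ∀ a b → ∃[ y ] y ∈ (a ⇒ b)
  ⇒-inhabited complemented a b with complemented a
  ... | x , x∈a⁺ = x ∨ (a ∧ b) , x , x∈a⁺ , refl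

  filter-contains-𝟙 : ∀ {p} {F : Pred Carrier p} → IsFilter F → 𝟙 ∈ F
  filter-contains-𝟙 ((x , x∈F) , ↑-closed , _) = ↑-closed x∈F (𝟙-greatest x)

  filter-isDeductiveSystem : Complemented → Modular
    → ∀ {p} (F : Pred Carrier p) → IsFilter F → IsDeductiveSystem F
  filter-isDeductiveSystem complemented modular F isFilter@(_ , ↑-closed , ∧-closed) =
    filter-contains-𝟙 isFilter , modus-ponens
    where
    modus-ponens : ∀ {a b} → a ∈ F → (∀ {y} → y ∈ (a ⇒ b) → y ∈ F) → b ∈ F
    modus-ponens {a} {b} a∈F a⇒b⊆F with ⇒-inhabited complemented a b
    ... | y , y∈a⇒b = ↑-closed (∧-closed a∈F (a⇒b⊆F y∈a⇒b)) (∧-⇒-element-≤ modular y∈a⇒b)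

proposition5p4 : ∀ {c ℓ p} (L : BoundedLattice c ℓ) → BoundedLattice.Nontrivial L
    → BoundedLattice.Complemented L → BoundedLattice.Modular L
    → (F : Pred (BoundedLattice.Carrier L) p) → BoundedLattice.IsFilter L F
    → BoundedLattice.IsDeductiveSystem L F
proposition5p4 L _ complemented modular =
  BoundedLatticeProperties.filter-isDeductiveSystem L complemented modular
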